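{- Let $n\ge1$ and let $X\subseteq B(n)\setminus E(B(n))$. The following conditions are equivalent: (i) $X$ is a face of ${\cal H}(B(n))$; (ii) there exists an enumeration $e_1,\dots,e_m$ of the edges of $\Gamma(X)$ such that, for $i=1,\dots,m$, $e_i$ is a separating edge of the subgraph of $\Gamma(X)$ obtained by removing the edges $e_{i+1},\dots,e_m$; (iii) every subgraph of $\Gamma(X)$ having at least one edge has a separating edge.
   Context: For $n\ge1$, $B(n)$ denotes the aperiodic Brandt semigroup: the set $(\{1,\dots,n\}\times\{1,\dots,n\})\cup\{0\}$, where $0$ is a zero element and $(i,j)(k,l)=(i,l)$ if $j=k$ and $(i,j)(k,l)=0$ otherwise. Its set of idempotents is $E(B(n))=\{0\}\cup\{(i,i)\mid 1\le i\le n\}$. For $Y\subseteq B(n)$, $Y^+$ denotes the subsemigroup generated by $Y$ ($\emptyset^+=\emptyset$). The subsemigroup complex ${\cal H}(B(n))$ has vertex set $B(n)$, and a subset $X$ is a face iff it admits an enumeration $x_1,\dots,x_k$ with $\emptyset\subset\{x_1\}^+\subset\{x_1,x_2\}^+\subset\cdots\subset\{x_1,\dots,x_k\}^+$ (all inclusions strict). For $X\subseteq B(n)\setminus E(B(n))$, $\Gamma(X)$ is the directed graph with vertex set $\{1,\dots,n\}$ and an edge $i\to j$ for each $(i,j)\in X$ (no loops, no multiple edges). In a directed graph, an edge $a\to b$ ($a\ne b$) is a separating edge if there is no directed path from $a$ to $b$ avoiding this edge (otherwise it is called a chord). -}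

module Defs where

open import Data.Nat using (ℕ; suc)
open import Data.Fin using (Fin; toℕ)
open import Data.Fin.Properties using (_≟_)
open import Data.Maybe using (Maybe; just; nothing)
open import Data.Product using (_×_; _,_; ∃; ∃-syntax)
open import Data.List using (List; take; length; lookup; map)
open import Data.List.Membership.Propositional using (_∈_)
open import Data.List.Relation.Unary.All using (All)
open import Data.List.Relation.Unary.Unique.Propositional using (Unique)
open import Data.List.Relation.Binary.Permutation.Propositional using (_↭_)
open import Relation.Binary.Construct.Closure.ReflexiveTransitive using (Star)
open import Relation.Binary.PropositionalEquality using (_≡_; _≢_)
open import Relation.Nullary using (¬_; yes; no)

-- The aperiodic Brandt semigroup B(n): nothing = 0, just (i , j) = (i,j).
B : ℕ → Set
B n = Maybe (Fin n × Fin n)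

_·_ : ∀ {n} → B n → B n → B n
nothing · _ = nothing
just _ · nothing = nothing
just (i , j) · just (k , l) with j ≟ k
... | yes _ = just (i , l)
... | no  _ = nothing

data Gen {n : ℕ} (Y : List (B n)) : B n → Set where
  gen : ∀ {y} → y ∈ Y → Gen Y y
  mul : ∀ {a b} → Gen Y a → Gen Y b → Gen Y (a · b)

_⊂_ : ∀ {A : Set} → (A → Set) → (A → Set) → Set
P ⊂ Q = (∀ z → P z → Q z) × ∃[ z ] (Q z × ¬ P z)

StrictChain : ∀ {n} → List (B n) → Set
StrictChain xs = ∀ (t : Fin (length xs)) →
  Gen (take (toℕ t) xs) ⊂ Gen (take (suc (toℕ t)) xs)

-- A finite set X ⊆ B(n), given as a duplicate-free list, is a face of H(B(n)).
IsFace : ∀ {n} → List (B n) → Set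
IsFace X = ∃[ xs ] (xs ↭ X × StrictChain xs)

-- Off-diagonal elements of B(n), i.e. B(n) ∖ E(B(n)), as pairs (i , j) with i ≢ j.
-- A set X ⊆ B(n)∖E(B(n)) is a duplicate-free list of such pairs; it is also
-- exactly the edge list of the directed graph Γ(X) on vertices Fin n.
Edge : ℕ → Set
Edge n = Fin n × Fin n

OffDiag : ∀ {n} → Edge n → Set
OffDiag (i , j) = i ≢ j

toB : ∀ {n} → List (Edge n) → List (B n)
toB = map just

StepAvoiding : ∀ {n} → List (Edge n) → Edge n → Fin n → Fin n → Set
StepAvoiding E e a b = ((a , b) ∈ E) × ((a , b) ≢ e)

Separating : ∀ {n} → List (Edge n) → Edge n → Set
Separating E (a , b) = ((a , b) ∈ E) × ¬ Star (StepAvoiding E (a , b)) a b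

SeparatingEnumeration : ∀ {n} → List (Edge n) → Set
SeparatingEnumeration X = ∃[ es ] (es ↭ X ×
  (∀ (i : Fin (length es)) → Separating (take (suc (toℕ i)) es) (lookup es i)))

EverySubgraphSeparating : ∀ {n} → List (Edge n) → Set
EverySubgraphSeparating {n} X =
  ∀ (Y : List (Edge n)) → (∀ {e} → e ∈ Y → e ∈ X) → ∃[ e ] (e ∈ Y) →
    ∃[ e ] (e ∈ Y × Separating Y e)

module Submission where

-- Everything rests on a dictionary between B(n) and digraphs: for an edge
-- list P, the element (a,b) lies in the subsemigroup generated by P iff Γ(P)
-- has a nonempty directed path from a to b (gen⇒path, path⇒gen).  Hence, if
-- P' is P with one new off-diagonal edge e = (a,b) adjoined, then
--   P⁺ ⊂ P'⁺ strictly  ⟺  e is a separating edge of Γ(P')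
-- (strict⇒separating, separating⇒strict): a path a → b avoiding e would put
-- (a,b), and with it all of P'⁺, into P⁺; conversely (a,b) itself is new.
-- Applied to consecutive prefixes of an enumeration (Stepwise, transported
-- along Edge n → B(n) by Stepwise-map⁺/⁻) this gives (i) ⇔ (ii).
-- (ii) ⇒ (iii): a subgraph Y takes as separating edge the last edge of the
-- enumeration lying in Y, since separating edges stay separating in subgraphs.
-- (iii) ⇒ (ii): remove a separating edge of the whole graph, enumerate the
-- rest recursively and put the removed edge last.

open import Data.Nat using (ℕ; suc; _≤_)
open import Data.Nat.Properties using (suc-injective)
open import Data.Fin as Fin using (Fin; toℕ)
open import Data.Fin.Properties using (_≟_)
open import Data.Product using (_×_; _,_; ∃; ∃-syntax)
open import Data.Product.Properties using (≡-dec)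
open import Data.Sum using (_⊎_; inj₁; inj₂; fromInj₁)
import Data.Sum as Sum
open import Data.Empty using (⊥-elim)
open import Data.Maybe using (just; nothing)
open import Data.List using (List; []; _∷_; _++_; _∷ʳ_; take; length; lookup; map)
open import Data.List.Properties using (take-suc)
open import Data.List.Membership.Propositional using (_∈_; _∉_; lose)
open import Data.List.Membership.Propositional.Properties
  using (∈-map⁺; ∈-map⁻; ∈-++⁺ˡ; ∈-++⁺ʳ; ∈-++⁻; ∈-∃++; ∈-lookup)
open import Data.List.Relation.Binary.Subset.Propositional using (_⊆_)
import Data.List.Relation.Binary.Subset.Propositional.Properties as Subset
open import Data.List.Relation.Unary.Any using (Any; here; there; any?)
open import Data.List.Relation.Unary.All as All using (All)
open import Data.List.Relation.Unary.AllPairs using (_∷_)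
open import Data.List.Relation.Unary.Unique.Propositional using (Unique)
open import Data.List.Relation.Binary.Permutation.Propositional
  using (_↭_; prep; ↭-sym; ↭⇒↭ₛ; module PermutationReasoning)
open import Data.List.Relation.Binary.Permutation.Propositional.Properties
  using (map⁺; ↭-map-inv; ∈-resp-↭; ↭-length; shift; ∷↭∷ʳ)
import Data.List.Relation.Binary.Permutation.Setoid.Properties as SetoidPerm
open import Relation.Binary.Construct.Closure.ReflexiveTransitive using (Star; ε; _◅_; _◅◅_)
import Relation.Binary.Construct.Closure.ReflexiveTransitive as Star
open import Relation.Binary.PropositionalEquality using (_≡_; _≢_; refl; sym; trans; subst; setoid)
open import Relation.Nullary using (Dec; yes; no)
open import Relation.Unary using (Decidable)
open import Function using (_∘_)
open import Function.Bundles using (_⇔_; mk⇔)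
open import Defs

private
  variable
    n : ℕ

·-factor : ∀ (x y : B n) {i l : Fin n} → x · y ≡ just (i , l) →
  ∃[ j ] (x ≡ just (i , j) × y ≡ just (j , l))
·-factor nothing _ ()
·-factor (just _) nothing ()
·-factor (just (i , j)) (just (k , l)) eq with j ≟ k | eq
... | yes refl | refl = j , refl , refl
... | no _ | ()

·-compose : ∀ (a c b : Fin n) → just (a , c) · just (c , b) ≡ just (a , b)
·-compose a c b with c ≟ c
... | yes _ = refl
... | no c≢c = ⊥-elim (c≢c refl)

Gen-least : ∀ {Y Y' : List (B n)} → (∀ {y} → y ∈ Y → Gen Y' y) → ∀ {z} → Gen Y z → Gen Y' z
Gen-least Y⊆Y'⁺ (gen y∈Y) = Y⊆Y'⁺ y∈Y
Gen-least Y⊆Y'⁺ (mul g h) = mul (Gen-least Y⊆Y'⁺ g) (Gen-least Y⊆Y'⁺ h)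

gen-edge : ∀ {P : List (Edge n)} {e} → e ∈ P → Gen (toB P) (just e)
gen-edge = gen ∘ ∈-map⁺ just

Path : List (Edge n) → Fin n → Fin n → Set
Path P = Star (λ a b → (a , b) ∈ P)

gen⇒path : ∀ {P : List (Edge n)} {a b} → Gen (toB P) (just (a , b)) → Path P a b
gen⇒path g = go g refl
  where
  -- The index of a product is not a pair syntactically, hence the equation.
  go : ∀ {P : List (Edge n)} {z a b} → Gen (toB P) z → z ≡ just (a , b) → Path P a b
  go (gen e∈P) refl with ∈-map⁻ just e∈P
  ... | _ , arc , refl = arc ◅ ε
  go (mul {x} {y} gx gy) xy≡ab with ·-factor x y xy≡ab
  ... | _ , refl , refl = go gx refl ◅◅ go gy refl

path⇒gen : ∀ {P : List (Edge n)} {a b} → Path P a b → a ≢ b → Gen (toB P) (just (a , b))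
path⇒gen ε a≢a = ⊥-elim (a≢a refl)
path⇒gen (arc ◅ rest) _ = go arc rest
  where
  go : ∀ {P : List (Edge n)} {a c b} → (a , c) ∈ P → Path P c b → Gen (toB P) (just (a , b))
  go arc ε = gen-edge arc
  go {a = a} {c} {b} arc (arc' ◅ rest) =
    subst (Gen _) (·-compose a c b) (mul (gen-edge arc) (go arc' rest))

-- If P' consists of P and the off-diagonal edge (a,b), and P'⁺ is strictly
-- larger than P⁺, then (a,b) is separating in Γ(P'): a detour from a to b
-- would lie in Γ(P), giving (a,b) ∈ P⁺ and so P'⁺ ⊆ P⁺.
strict⇒separating : ∀ {P P' : List (Edge n)} {a b} → a ≢ b → (a , b) ∈ P' →
  (∀ {y} → y ∈ P' → y ∈ P ⊎ y ≡ (a , b)) →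
  Gen (toB P) ⊂ Gen (toB P') → Separating P' (a , b)
strict⇒separating {P = P} {P'} {a} {b} a≢b ab∈P' P'⊆P+ab (_ , z , z∈P'⁺ , z∉P⁺) =
  ab∈P' , λ detour → z∉P⁺ (Gen-least (P'⊆P⁺ (path⇒gen (Star.map inP detour) a≢b)) z∈P'⁺)
  where
  inP : ∀ {i j} → StepAvoiding P' (a , b) i j → (i , j) ∈ P
  inP (ij∈P' , ij≢ab) = fromInj₁ (⊥-elim ∘ ij≢ab) (P'⊆P+ab ij∈P')
  P'⊆P⁺ : Gen (toB P) (just (a , b)) → ∀ {y} → y ∈ toB P' → Gen (toB P) y
  P'⊆P⁺ ab∈P⁺ y∈P' with ∈-map⁻ just y∈P'
  ... | e , e∈P' , refl with P'⊆P+ab e∈P'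
  ... | inj₁ e∈P = gen-edge e∈P
  ... | inj₂ refl = ab∈P⁺

-- If P ⊆ P', the edge (a,b) ∉ P is separating in Γ(P'), then P⁺ ⊂ P'⁺
-- strictly, witnessed by (a,b): a path for it in Γ(P) would be a detour.
separating⇒strict : ∀ {P P' : List (Edge n)} {a b} → P ⊆ P' → (a , b) ∉ P →
  Separating P' (a , b) → Gen (toB P) ⊂ Gen (toB P')
separating⇒strict {P = P} {P'} P⊆P' ab∉P (ab∈P' , noDetour) =
  (λ _ → Gen-least (gen ∘ Subset.map⁺ just P⊆P')) ,
  _ , gen-edge ab∈P' , λ ab∈P⁺ → noDetour (Star.map avoid (gen⇒path ab∈P⁺))
  where
  avoid : ∀ {i j} → (i , j) ∈ P → StepAvoiding P' _ i j
  avoid ij∈P = P⊆P' ij∈P , λ ij≡ab → ab∉P (subst (_∈ P) ij≡ab ij∈P)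

separating-antitone : ∀ {E E' : List (Edge n)} {e} → E ⊆ E' → e ∈ E →
  Separating E' e → Separating E e
separating-antitone E⊆E' e∈E (_ , noDetour) =
  e∈E , λ detour → noDetour (Star.map (Data.Product.map₁ E⊆E') detour)

-- StrictChain and the condition in
-- SeparatingEnumeration unfold to instances of it.
Stepwise : ∀ {A : Set} → (List A → A → List A → Set) → List A → Set
Stepwise Q xs = ∀ (t : Fin (length xs)) → Q (take (toℕ t) xs) (lookup xs t) (take (suc (toℕ t)) xs)

StrictStep : List (B n) → B n → List (B n) → Set
StrictStep P _ P' = Gen P ⊂ Gen P'

SeparatingStep : List (Edge n) → Edge n → List (Edge n) → Set
SeparatingStep _ e P' = Separating P' e

Stepwise-map⁺ : ∀ {A C : Set} (f : A → C) {Q : List C → C → List C → Set} (xs : List A) →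
  Stepwise (λ p x p' → Q (map f p) (f x) (map f p')) xs → Stepwise Q (map f xs)
Stepwise-map⁺ f (x ∷ xs) h Fin.zero = h Fin.zero
Stepwise-map⁺ f {Q} (x ∷ xs) h (Fin.suc t) =
  Stepwise-map⁺ f {λ p y p' → Q (f x ∷ p) y (f x ∷ p')} xs (h ∘ Fin.suc) t

Stepwise-map⁻ : ∀ {A C : Set} (f : A → C) {Q : List C → C → List C → Set} (xs : List A) →
  Stepwise Q (map f xs) → Stepwise (λ p x p' → Q (map f p) (f x) (map f p')) xs
Stepwise-map⁻ f (x ∷ xs) h Fin.zero = h Fin.zero
Stepwise-map⁻ f {Q} (x ∷ xs) h (Fin.suc t) =
  Stepwise-map⁻ f {λ p y p' → Q (f x ∷ p) y (f x ∷ p')} xs (h ∘ Fin.suc) t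

Stepwise-∷ʳ : ∀ {A : Set} {Q : List A → A → List A → Set} (xs : List A) (y : A) →
  Stepwise Q xs → Q xs y (xs ∷ʳ y) → Stepwise Q (xs ∷ʳ y)
Stepwise-∷ʳ [] y _ q Fin.zero = q
Stepwise-∷ʳ (x ∷ xs) y h q Fin.zero = h Fin.zero
Stepwise-∷ʳ {Q = Q} (x ∷ xs) y h q (Fin.suc t) =
  Stepwise-∷ʳ {Q = λ p z p' → Q (x ∷ p) z (x ∷ p')} xs y (h ∘ Fin.suc) q t

-- Consecutive prefixes: take (suc t) xs is take t xs with lookup xs t appended
-- (library lemma take-suc), so it is a one-element extension.
module _ {A : Set} (xs : List A) (t : Fin (length xs)) where

  lookup∈take-suc : lookup xs t ∈ take (suc (toℕ t)) xs
  lookup∈take-suc = subst (lookup xs t ∈_) (sym (take-suc xs t)) (∈-++⁺ʳ (take (toℕ t) xs) (here refl))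

  take⊆take-suc : take (toℕ t) xs ⊆ take (suc (toℕ t)) xs
  take⊆take-suc y∈ = subst (_ ∈_) (sym (take-suc xs t)) (∈-++⁺ˡ y∈)

  take-suc⊆ : ∀ {y} → y ∈ take (suc (toℕ t)) xs → y ∈ take (toℕ t) xs ⊎ y ≡ lookup xs t
  take-suc⊆ y∈ = Sum.map₂ (λ { (here y≡) → y≡ }) (∈-++⁻ (take (toℕ t) xs) (subst (_ ∈_) (take-suc xs t) y∈))

unique⇒lookup∉take : ∀ {A : Set} (xs : List A) → Unique xs → (t : Fin (length xs)) →
  lookup xs t ∉ take (toℕ t) xs
unique⇒lookup∉take (x ∷ xs) (x∉xs ∷ _) (Fin.suc t) (here t≡x) = All.lookup x∉xs (∈-lookup t) (sym t≡x)
unique⇒lookup∉take (x ∷ xs) (_ ∷ unique) (Fin.suc t) (there t∈) = unique⇒lookup∉take xs unique t t∈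

last-satisfying : ∀ {A : Set} {P : A → Set} → Decidable P → (xs : List A) → Any P xs →
  ∃ λ (t : Fin (length xs)) → P (lookup xs t) × (∀ {z} → z ∈ xs → P z → z ∈ take (suc (toℕ t)) xs)
last-satisfying {P = P} P? (x ∷ xs) anyP with any? P? xs
... | yes anyTail =
  let (t , Pt , bound) = last-satisfying P? xs anyTail
  in Fin.suc t , Pt , λ { (here refl) _ → here refl ; (there z∈) Pz → there (bound z∈ Pz) }
... | no noneTail = Fin.zero , headP anyP , λ { (here refl) _ → here refl ; (there z∈) Pz → ⊥-elim (noneTail (lose z∈ Pz)) }
  where
  headP : Any P (x ∷ xs) → P x
  headP (here Px) = Px
  headP (there anyTail) = ⊥-elim (noneTail anyTail)

face⇒enumeration : ∀ {X : List (Edge n)} → All OffDiag X → IsFace (toB X) → SeparatingEnumeration X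
face⇒enumeration offDiag (xs , xs↭X , chain) with ↭-map-inv just (↭-sym xs↭X)
... | es , refl , X↭es = es , ↭-sym X↭es , λ t →
  strict⇒separating (All.lookup offDiag (∈-resp-↭ (↭-sym X↭es) (∈-lookup t)))
    (lookup∈take-suc es t) (take-suc⊆ es t) (Stepwise-map⁻ just {StrictStep} es chain t)

-- (ii) ⇒ (i): each separating edge is new (X has no duplicates) and so makes
-- the generated subsemigroup grow strictly.
enumeration⇒face : ∀ {X : List (Edge n)} → Unique X → SeparatingEnumeration X → IsFace (toB X)
enumeration⇒face {n} unique (es , es↭X , separating) =
  toB es , map⁺ just es↭X , Stepwise-map⁺ just {StrictStep} es λ t →
    separating⇒strict (take⊆take-suc es t) (unique⇒lookup∉take es uniqueEs t) (separating t)
  where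
  uniqueEs : Unique es
  uniqueEs = SetoidPerm.Unique-resp-↭ (setoid (Edge n)) (↭⇒↭ₛ (↭-sym es↭X)) unique

_∈?_ : (e : Edge n) (Y : List (Edge n)) → Dec (e ∈ Y)
e ∈? Y = any? (≡-dec _≟_ _≟_ e) Y

-- (ii) ⇒ (iii): the last edge of the enumeration lying in Y is separating in Y.
enumeration⇒subgraphs : ∀ {X : List (Edge n)} → SeparatingEnumeration X → EverySubgraphSeparating X
enumeration⇒subgraphs (es , es↭X , separating) Y Y⊆X (y , y∈Y) =
  let (t , lastInY , Y⊆prefix) = last-satisfying (_∈? Y) es (lose (Y⊆es y∈Y) y∈Y)
  in lookup es t , lastInY ,
     separating-antitone (λ e∈Y → Y⊆prefix (Y⊆es e∈Y) e∈Y) lastInY (separating t)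
  where
  Y⊆es : Y ⊆ es
  Y⊆es = ∈-resp-↭ (↭-sym es↭X) ∘ Y⊆X

enumeration-∷ʳ : ∀ {X rest : List (Edge n)} {e} → X ↭ e ∷ rest → Separating X e →
  SeparatingEnumeration rest → SeparatingEnumeration X
enumeration-∷ʳ {X = X} {rest} {e} X↭ separatingX (es , es↭rest , separating) =
  es ∷ʳ e , esE↭X ,
  Stepwise-∷ʳ {Q = SeparatingStep} es e separating
    (separating-antitone (∈-resp-↭ esE↭X) (∈-++⁺ʳ es (here refl)) separatingX)
  where
  open PermutationReasoning
  esE↭X : es ∷ʳ e ↭ X
  esE↭X = begin
    es ∷ʳ e   ↭⟨ ∷↭∷ʳ e es ⟨
    e ∷ es    ↭⟨ prep e es↭rest ⟩
    e ∷ rest  ↭⟨ X↭ ⟨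
    X         ∎

∈⇒↭∷ : ∀ {A : Set} {x : A} {xs} → x ∈ xs → ∃[ rest ] (xs ↭ x ∷ rest)
∈⇒↭∷ x∈xs with us , vs , refl ← ∈-∃++ x∈xs = us ++ vs , shift _ us vs

subgraphs⇒enumeration : ∀ (m : ℕ) {X : List (Edge n)} → length X ≡ m →
  EverySubgraphSeparating X → SeparatingEnumeration X
subgraphs⇒enumeration _ {[]} _ _ = [] , _↭_.refl , λ ()
subgraphs⇒enumeration (suc m) {X@(x ∷ _)} |X|≡ everySep
  with e , e∈X , separatingX ← everySep X (λ e∈ → e∈) (x , here refl)
  with rest , X↭ ← ∈⇒↭∷ e∈X =
  enumeration-∷ʳ X↭ separatingX
    (subgraphs⇒enumeration m (suc-injective (trans (sym (↭-length X↭)) |X|≡))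
      (λ Y Y⊆rest → everySep Y (∈-resp-↭ (↭-sym X↭) ∘ there ∘ Y⊆rest)))

lemma5p13 : (n : ℕ) → 1 ≤ n → (X : List (Edge n)) → Unique X → All OffDiag X →
    (IsFace (toB X) ⇔ SeparatingEnumeration X) × (SeparatingEnumeration X ⇔ EverySubgraphSeparating X)
lemma5p13 _ _ X unique offDiag =
  mk⇔ (face⇒enumeration offDiag) (enumeration⇒face unique) ,
  mk⇔ enumeration⇒subgraphs (subgraphs⇒enumeration (length X) refl)
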